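{- Let $d\geq 3$ be a natural number. There is a relational signature $\sigma_d$ and a sequence $(\phi_h)_{h\geq1}$ of first-order sentences over $\sigma_d$ of size $O(h)$ such that for each $h\geq1$, every sentence in Barthelmann-Schwentick normal form that is equivalent to $\phi_h$ on all $\sigma_d$-structures of degree $\leq d$ has size $>2^{(d-1)^{2^h}}$.
   Context: Structures are finite with non-empty universe; the degree of a structure is the maximum degree of its Gaifman graph (vertices the elements, edges between distinct elements occurring together in some tuple of some relation). The size of a formula is its length as a word. A formula $\phi(\overline{y},z)$ is $r$-local around $z$ if for every structure $\mathcal{A}$ and all tuples, $\mathcal{A}\models\phi[\overline{a},c]$ iff $\mathcal{A}[\{\text{entries of }\overline{a}\}\cup N_r^{\mathcal{A}}(c)]\models\phi[\overline{a},c]$, where $N_r^{\mathcal{A}}(c)$ is the set of elements at Gaifman distance $\leq r$ from $c$. A sentence is in Barthelmann-Schwentick normal form if it has the form $\exists y_1\cdots\exists y_n\forall z\,\phi(y_1,\dots,y_n,z)$ with $n\ge0$ and $\phi$ $r$-local around $z$ for some $r\geq0$. -}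

module Defs where

open import Data.Nat using (ℕ; zero; suc; _+_; _*_)
open import Data.Fin using (Fin; zero; suc)
open import Data.Vec using (Vec; map)
open import Data.Vec.Membership.Propositional using (_∈_)
open import Data.Bool using (Bool; T)
open import Data.Product using (Σ; _×_; _,_; proj₁)
open import Data.Sum using (_⊎_; inj₁; inj₂)
open import Relation.Nullary using (¬_)
open import Relation.Binary.PropositionalEquality using (_≡_; _≢_; refl)
open import Function.Bundles using (_⇔_; Equivalence)
open import Function.Definitions using (Injective)

record Signature : Set where
  field
    #rel  : ℕ
    arity : Fin #rel → ℕ
open Signature public

-- First-order formulas over σ, well-scoped de Bruijn syntax:
-- Formula σ k = formulas with free variables among Fin k.
-- Quantifiers bind the new variable as index zero.
data Formula (σ : Signature) : ℕ → Set where
  rel  : ∀ {k} (R : Fin (#rel σ)) → Vec (Fin k) (arity σ R) → Formula σ k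
  eq   : ∀ {k} → Fin k → Fin k → Formula σ k
  neg  : ∀ {k} → Formula σ k → Formula σ k
  and  : ∀ {k} → Formula σ k → Formula σ k → Formula σ k
  or   : ∀ {k} → Formula σ k → Formula σ k → Formula σ k
  ex   : ∀ {k} → Formula σ (suc k) → Formula σ k
  all  : ∀ {k} → Formula σ (suc k) → Formula σ k

Sentence : Signature → Set
Sentence σ = Formula σ 0

-- Length as a word (fully parenthesised infix, each variable one letter):
--   R            (arity 0)        : 1
--   R(x1,...,xn) (arity n ≥ 1)    : 2n+2
--   x = y : 3 ;  ¬φ : 1+|φ| ; (φ∧ψ),(φ∨ψ) : 3+|φ|+|ψ| ; ∃xφ, ∀xφ : 2+|φ|
atomSize : ℕ → ℕ
atomSize zero    = 1
atomSize (suc n) = 2 * suc n + 2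

size : ∀ {σ k} → Formula σ k → ℕ
size {σ} (rel R _) = atomSize (arity σ R)
size (eq _ _)      = 3
size (neg φ)       = 1 + size φ
size (and φ ψ)     = 3 + size φ + size ψ
size (or φ ψ)      = 3 + size φ + size ψ
size (ex φ)        = 2 + size φ
size (all φ)       = 2 + size φ

Rels : Signature → Set → Set
Rels σ U = (R : Fin (#rel σ)) → Vec U (arity σ R) → Bool

ext : ∀ {U : Set} {k} → U → (Fin k → U) → Fin (suc k) → U
ext a ρ zero    = a
ext a ρ (suc i) = ρ i

Sat : ∀ {σ} {U : Set} {k} → Rels σ U → Formula σ k → (Fin k → U) → Set
Sat I (rel R xs) ρ = T (I R (map ρ xs))
Sat I (eq x y)   ρ = ρ x ≡ ρ y
Sat I (neg φ)    ρ = ¬ Sat I φ ρ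
Sat I (and φ ψ)  ρ = Sat I φ ρ × Sat I ψ ρ
Sat I (or φ ψ)   ρ = Sat I φ ρ ⊎ Sat I ψ ρ
Sat {U = U} I (ex φ)  ρ = Σ U (λ a → Sat I φ (ext a ρ))
Sat {U = U} I (all φ) ρ = (a : U) → Sat I φ (ext a ρ)

-- A (finite, non-empty) σ-structure is, up to isomorphism, given by m and
-- I : Rels σ (Fin (suc m)) (universe Fin (suc m)).

Adj : ∀ {σ} {U : Set} → Rels σ U → U → U → Set
Adj {σ} {U} I a b =
  a ≢ b × Σ (Fin (#rel σ)) (λ R → Σ (Vec U (arity σ R)) (λ t →
    T (I R t) × a ∈ t × b ∈ t))

Dist≤ : ∀ {σ} {U : Set} → Rels σ U → ℕ → U → U → Set
Dist≤ I zero    a b = a ≡ b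
Dist≤ {U = U} I (suc r) a b = Dist≤ I r a b ⊎ Σ U (λ c → Adj I a c × Dist≤ I r c b)

dist-refl : ∀ {σ} {U : Set} (I : Rels σ U) r (a : U) → Dist≤ I r a a
dist-refl I zero    a = refl
dist-refl I (suc r) a = inj₁ (dist-refl I r a)

Degree≤ : ∀ {σ m} → ℕ → Rels σ (Fin (suc m)) → Set
Degree≤ {m = m} d I = ∀ (a : Fin (suc m)) (f : Fin (suc d) → Fin (suc m)) →
  Injective _≡_ _≡_ f → ¬ (∀ i → Adj I a (f i))

restrict : ∀ {σ} {U : Set} → Rels σ U → (s : U → Bool) → Rels σ (Σ U (λ a → T (s a)))
restrict I s R t = I R (map proj₁ t)

-- The set {ρ(suc i) | i} ∪ N_r(ρ zero) (ȳ = variables suc i, z = variable zero).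
InLocal : ∀ {σ} {U : Set} {n} → Rels σ U → ℕ → (Fin (suc n) → U) → U → Set
InLocal {n = n} I r ρ a = Σ (Fin n) (λ i → ρ (suc i) ≡ a) ⊎ Dist≤ I r (ρ zero) a

inLocal : ∀ {σ} {U : Set} {n} (I : Rels σ U) r (ρ : Fin (suc n) → U) j → InLocal I r ρ (ρ j)
inLocal I r ρ zero    = inj₂ (dist-refl I r (ρ zero))
inLocal I r ρ (suc i) = inj₁ (i , refl)

restrictEnv : ∀ {σ} {U : Set} {n} (I : Rels σ U) r (ρ : Fin (suc n) → U) (s : U → Bool) →
  (∀ a → T (s a) ⇔ InLocal I r ρ a) → Fin (suc n) → Σ U (λ a → T (s a))
restrictEnv I r ρ s iff j = ρ j , Equivalence.from (iff (ρ j)) (inLocal I r ρ j)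

-- φ(ȳ, z) with z = variable zero, ȳ = the remaining variables, is r-local around z.
Local : ∀ {σ n} → ℕ → Formula σ (suc n) → Set
Local {σ} {n} r φ = ∀ m (I : Rels σ (Fin (suc m))) (ρ : Fin (suc n) → Fin (suc m))
  (s : Fin (suc m) → Bool) (iff : ∀ a → T (s a) ⇔ InLocal I r ρ a) →
  Sat I φ ρ ⇔ Sat (restrict I s) φ (restrictEnv I r ρ s iff)

exs : ∀ {σ} n {k} → Formula σ (n + k) → Formula σ k
exs zero    φ = φ
exs (suc n) φ = exs n (ex φ)

BSNF : ∀ {σ} → Sentence σ → Set
BSNF {σ} ψ = Σ ℕ (λ n → Σ ℕ (λ r → Σ (Formula σ (suc (n + 0))) (λ φ →
  Local r φ × ψ ≡ exs n (all φ))))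

EquivDeg≤ : ∀ {σ} → ℕ → Sentence σ → Sentence σ → Set
EquivDeg≤ {σ} d φ ψ = ∀ m (I : Rels σ (Fin (suc m))) → Degree≤ d I →
  Sat I φ (λ ()) ⇔ Sat I ψ (λ ())

module Submission where

-- Over σ₀ = {P, Root, E₀, E₁}, let 𝔄 be the forest containing, for every P-labelling
-- c of the complete binary tree of depth 2^K, one copy of that tree labelled by c,
-- and let 𝔅 c₀ be 𝔄 plus a second copy labelled c₀.  Both have degree ≤ 3.  The
-- sentence φ K ("distinct roots carry distinct labellings") has size O(K) thanks to
-- the path-doubling formula S; it holds in 𝔄 and fails in every 𝔅 c₀.
-- Now let ψ = ∃y₁…∃yₙ∀z θ with θ local and n smaller than the number of labellings.
-- If 𝔄 ⊨ ψ, pick a labelling c₀ whose copy contains no witness yᵢ.  Then 𝔅 c₀ ⊨ ψ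
-- with the same witnesses: for z in a copy of 𝔄 by locality, since 𝔄 embeds into
-- 𝔅 c₀ as a union of connected components; for z in the new copy after applying
-- the automorphism of 𝔅 c₀ exchanging the two copies labelled c₀.  So ψ is not
-- equivalent to φ K unless n, hence |ψ|, is at least 2^(#nodes) ≥ 2^(2^(2^K)).

open import Defs
open import Data.Nat using (ℕ; zero; suc; _+_; _*_; _∸_; _^_; _≤_; _<_; z≤n; s≤s; _≤?_)
open import Data.Nat.Properties
  using ( +-suc; +-assoc; +-comm; +-identityʳ; +-mono-≤; *-comm; *-distribʳ-+
        ; m<m+n; m≤n+m; m≤m*n; n≤1+n; m∸n≤m; m+[n∸m]≡n; m+n∸m≡n; ∸-monoˡ-≤
        ; ≤-refl; ≤-reflexive; ≤-trans; <-≤-trans; <⇒≤; <⇒≱; ≰⇒>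
        ; m^n>0; ^-monoˡ-≤; ^-monoʳ-≤; ^-*-assoc; ^-distribˡ-+-*; module ≤-Reasoning )
open import Data.Fin using (Fin; zero; suc; _≟_; _↑ʳ_)
open import Data.Fin.Properties using (any?; pigeonhole; ¬∀⟶∃¬; injective⇒≤; +↔⊎; *↔×; 1↔⊤; 2↔Bool; <⇒≢)
open import Data.Vec using (Vec; []; _∷_; map; lookup; tabulate)
open import Data.Vec.Properties using (map-cong; map-∘; map-id; tabulate∘lookup; tabulate-cong)
import Data.Vec.Properties as Vecₚ
open import Data.Vec.Membership.Propositional using (_∈_)
open import Data.Vec.Membership.Propositional.Properties using (∈-map⁺)
open import Data.Vec.Relation.Unary.Any using (here; there)
import Data.Vec.Membership.DecPropositional as DecMembership
open import Data.Bool using (Bool; T; true; false)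
open import Data.Bool.Properties using (T?; T-irrelevant)
import Data.Bool.Properties as Boolₚ
open import Data.Maybe using (Maybe; nothing; just; fromMaybe)
import Data.Maybe.Properties as Maybeₚ
open import Data.Unit using (⊤; tt)
open import Data.Empty using (⊥-elim)
open import Data.Product using (Σ; ∃; ∃₂; _×_; _,_; proj₁; proj₂; map₁; uncurry)
import Data.Product.Properties as Productₚ
open import Data.Product.Function.NonDependent.Propositional using (_×-⇔_; _×-↔_)
open import Data.Sum using (_⊎_; inj₁; inj₂)
open import Data.Sum.Function.Propositional using (_⊎-⇔_; _⊎-↔_)
open import Function using (_∘_; id)
open import Function.Bundles using (_⇔_; _↔_; mk⇔; Equivalence; Inverse; Injection; mk↔ₛ′)
open import Function.Properties.Inverse using (↔-refl; ↔-trans; ↔-sym; ↔⇒↣)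
open import Function.Related.TypeIsomorphisms using (¬-cong-⇔)
open import Relation.Nullary using (¬_; Dec; yes; no)
open import Relation.Nullary.Decidable
  using (⌊_⌋; toWitness; fromWitness; _×-dec_; _⊎-dec_; ¬?; does-⇔; isYes≗does; dec-no)
import Relation.Nullary.Decidable as Dec
open import Relation.Binary.Definitions using (DecidableEquality)
open import Relation.Binary.PropositionalEquality

↔-injective : ∀ {A B : Set} (e : A ↔ B) {a b} → Inverse.to e a ≡ Inverse.to e b → a ≡ b
↔-injective e = Injection.injective (↔⇒↣ e)

module Isomorphism {σ : Signature} {U V : Set} (I : Rels σ U) (J : Rels σ V)
    (e : U ↔ V) (preserves : ∀ R t → I R t ≡ J R (map (Inverse.to e) t)) where

  private
    f : U → V
    f = Inverse.to e
    f⁻¹ : V → U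
    f⁻¹ = Inverse.from e

  _↦_ : ∀ {k} → (Fin k → U) → (Fin k → V) → Set
  ρ ↦ ρ′ = ∀ i → ρ′ i ≡ f (ρ i)

  ↦-ext : ∀ {k} {ρ : Fin k → U} {ρ′ a b} → ρ ↦ ρ′ → b ≡ f a → ext a ρ ↦ ext b ρ′
  ↦-ext ρ↦ρ′ b≡fa zero    = b≡fa
  ↦-ext ρ↦ρ′ b≡fa (suc i) = ρ↦ρ′ i

  ↦-ext⁻¹ : ∀ {k} {ρ : Fin k → U} {ρ′} → ρ ↦ ρ′ → ∀ b → ext (f⁻¹ b) ρ ↦ ext b ρ′
  ↦-ext⁻¹ ρ↦ρ′ b = ↦-ext ρ↦ρ′ (sym (Inverse.strictlyInverseˡ e b))

  atom-≡ : ∀ {k} R (xs : Vec (Fin k) (arity σ R)) {ρ ρ′} → ρ ↦ ρ′ →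
    I R (map ρ xs) ≡ J R (map ρ′ xs)
  atom-≡ R xs {ρ} {ρ′} ρ↦ρ′ = begin
    I R (map ρ xs)         ≡⟨ preserves R (map ρ xs) ⟩
    J R (map f (map ρ xs)) ≡⟨ cong (J R) (map-∘ f ρ xs) ⟨
    J R (map (f ∘ ρ) xs)   ≡⟨ cong (J R) (map-cong (sym ∘ ρ↦ρ′) xs) ⟩
    J R (map ρ′ xs)        ∎
    where open ≡-Reasoning

  Sat-↔ : ∀ {k} (φ : Formula σ k) {ρ ρ′} → ρ ↦ ρ′ → Sat I φ ρ ⇔ Sat J φ ρ′
  Sat-↔ (rel R xs) ρ↦ρ′ = mk⇔ (subst T (atom-≡ R xs ρ↦ρ′)) (subst T (sym (atom-≡ R xs ρ↦ρ′)))
  Sat-↔ (eq x y) ρ↦ρ′ = mk⇔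
    (λ p → trans (ρ↦ρ′ x) (trans (cong f p) (sym (ρ↦ρ′ y))))
    (λ p → ↔-injective e (trans (sym (ρ↦ρ′ x)) (trans p (ρ↦ρ′ y))))
  Sat-↔ (neg φ)   ρ↦ρ′ = ¬-cong-⇔ (Sat-↔ φ ρ↦ρ′)
  Sat-↔ (and φ ψ) ρ↦ρ′ = Sat-↔ φ ρ↦ρ′ ×-⇔ Sat-↔ ψ ρ↦ρ′
  Sat-↔ (or φ ψ)  ρ↦ρ′ = Sat-↔ φ ρ↦ρ′ ⊎-⇔ Sat-↔ ψ ρ↦ρ′
  Sat-↔ (ex φ)    ρ↦ρ′ = mk⇔
    (λ (a , s) → f a , Equivalence.to (Sat-↔ φ (↦-ext ρ↦ρ′ refl)) s)
    (λ (b , s) → f⁻¹ b , Equivalence.from (Sat-↔ φ (↦-ext⁻¹ ρ↦ρ′ b)) s)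
  Sat-↔ (all φ)   ρ↦ρ′ = mk⇔
    (λ s b → Equivalence.to (Sat-↔ φ (↦-ext⁻¹ ρ↦ρ′ b)) (s (f⁻¹ b)))
    (λ s a → Equivalence.from (Sat-↔ φ (↦-ext ρ↦ρ′ refl)) (s (f a)))

open Isomorphism using (Sat-↔)

Sat-ext : ∀ {σ} {U : Set} {k} (I : Rels σ U) (φ : Formula σ k) {ρ ρ′ : Fin k → U} →
  (∀ i → ρ′ i ≡ ρ i) → Sat I φ ρ → Sat I φ ρ′
Sat-ext I φ ρ′≗ρ = Equivalence.to
  (Sat-↔ I I ↔-refl (λ R t → cong (I R) (sym (map-id t))) φ ρ′≗ρ)

Sat-exs⁻ : ∀ {σ} {U : Set} (I : Rels σ U) n {k} (θ : Formula σ (n + k)) (ρ : Fin k → U) →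
  Sat I (exs n θ) ρ → Σ (Fin (n + k) → U) (Sat I θ)
Sat-exs⁻ I zero    θ ρ s = ρ , s
Sat-exs⁻ I (suc n) θ ρ s with Sat-exs⁻ I n (ex θ) ρ s
... | τ , (a , s′) = ext a τ , s′

Sat-exs⁺ : ∀ {σ} {U : Set} (I : Rels σ U) n {k} (θ : Formula σ (n + k)) (τ : Fin (n + k) → U) →
  Sat I θ τ → Sat I (exs n θ) (λ i → τ (n ↑ʳ i))
Sat-exs⁺ I zero    θ τ s = s
Sat-exs⁺ I (suc n) θ τ s = Sat-exs⁺ I n (ex θ) (τ ∘ suc) (τ zero , Sat-ext I θ ext-η s)
  where
  ext-η : ∀ i → ext (τ zero) (τ ∘ suc) i ≡ τ i
  ext-η zero    = refl
  ext-η (suc i) = refl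

size-exs : ∀ {σ} n {k} (θ : Formula σ (n + k)) → size (exs n θ) ≡ n + n + size θ
size-exs zero    θ = refl
size-exs (suc n) θ = begin
  size (exs n (ex θ))        ≡⟨ size-exs n (ex θ) ⟩
  n + n + suc (suc (size θ)) ≡⟨ +-suc (n + n) (suc (size θ)) ⟩
  suc (n + n + suc (size θ)) ≡⟨ cong suc (+-suc (n + n) (size θ)) ⟩
  suc (suc (n + n + size θ)) ≡⟨ cong (λ x → suc (x + size θ)) (+-suc n n) ⟨
  suc n + suc n + size θ     ∎
  where open ≡-Reasoning

exs-all-size : ∀ {σ} n {k} (θ : Formula σ (suc (n + k))) → n < size (exs n (all θ))
exs-all-size n θ rewrite size-exs n (all θ) | +-assoc n n (size (all θ)) =
  m<m+n n (≤-trans (s≤s z≤n) (m≤n+m (size (all θ)) n))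

∃-Vec? : ∀ {N} k (P : Vec (Fin N) k → Set) → (∀ t → Dec (P t)) → Dec (∃ P)
∃-Vec? zero    P P? = Dec.map′ ([] ,_) (λ { ([] , p) → p }) (P? [])
∃-Vec? (suc k) P P? = Dec.map′
  (λ (x , t , p) → x ∷ t , p) (λ { (x ∷ t , p) → x , t , p })
  (any? (λ x → ∃-Vec? k (P ∘ (x ∷_)) (P? ∘ (x ∷_))))

-- On a finite carrier, Gaifman adjacency, bounded distance and membership in the
-- neighbourhood ȳ ∪ N_r(z) are decidable; hence the neighbourhood has a
-- characteristic function, as required to instantiate the definition of locality.
module Neighbourhood {σ : Signature} {m : ℕ} (I : Rels σ (Fin (suc m))) where
  open DecMembership (_≟_ {suc m}) using (_∈?_)

  adj? : ∀ a b → Dec (Adj I a b)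
  adj? a b = ¬? (a ≟ b) ×-dec any? (λ R → ∃-Vec? _ (λ t → T (I R t) × a ∈ t × b ∈ t)
    (λ t → T? (I R t) ×-dec (a ∈? t ×-dec b ∈? t)))

  dist? : ∀ r a b → Dec (Dist≤ I r a b)
  dist? zero    a b = a ≟ b
  dist? (suc r) a b = dist? r a b ⊎-dec any? (λ c → adj? a c ×-dec dist? r c b)

  local : ∀ {n} r (ρ : Fin (suc n) → Fin (suc m)) → Fin (suc m) → Bool
  local r ρ a = ⌊ any? (λ i → ρ (suc i) ≟ a) ⊎-dec dist? r (ρ zero) a ⌋

  local-spec : ∀ {n} r (ρ : Fin (suc n) → Fin (suc m)) a → T (local r ρ a) ⇔ InLocal I r ρ a
  local-spec r ρ a = mk⇔ toWitness fromWitness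

subset-≡ : ∀ {U : Set} {s : U → Bool} {a a′ : U} (p : T (s a)) (p′ : T (s a′)) → a ≡ a′ →
  _≡_ {A = Σ U (T ∘ s)} (a , p) (a′ , p′)
subset-≡ p p′ refl = cong (_ ,_) (T-irrelevant p p′)

-- emb embeds I into J as a union of connected components: it reflects every
-- relation, has a retraction, and every true J-tuple meeting the image lies in it.
record ComponentEmbedding {σ : Signature} {U V : Set} (I : Rels σ U) (J : Rels σ V) : Set where
  field
    emb         : U → V
    retract     : V → U
    retract∘emb : ∀ a → retract (emb a) ≡ a
    reflects    : ∀ R t → I R t ≡ J R (map emb t)
    closed      : ∀ R t a → T (J R t) → emb a ∈ t → ∀ b → b ∈ t → emb (retract b) ≡ b

  emb-injective : ∀ {a b} → emb a ≡ emb b → a ≡ b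
  emb-injective {a} {b} e = trans (sym (retract∘emb a)) (trans (cong retract e) (retract∘emb b))

-- Local formulas transfer along component embeddings: the r-neighbourhood of a
-- centre and parameters in I is isomorphic, via emb, to that of their images in J.
module ComponentTransfer {σ : Signature} {m₁ m₂ : ℕ}
    {I : Rels σ (Fin (suc m₁))} {J : Rels σ (Fin (suc m₂))} (G : ComponentEmbedding I J) where
  open ComponentEmbedding G
  open Neighbourhood using (local; local-spec)

  private
    emb∘retract-on : ∀ {k} (t : Vec (Fin (suc m₂)) k) → (∀ b → b ∈ t → emb (retract b) ≡ b) →
      map emb (map retract t) ≡ t
    emb∘retract-on []      h = refl
    emb∘retract-on (b ∷ t) h = cong₂ _∷_ (h b (here refl)) (emb∘retract-on t (λ c → h c ∘ there))

  Adj-emb : ∀ {a b} → Adj I a b → Adj J (emb a) (emb b)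
  Adj-emb (a≢b , R , t , Rt , a∈t , b∈t) =
    (a≢b ∘ emb-injective) , R , map emb t , subst T (reflects R t) Rt , ∈-map⁺ emb a∈t , ∈-map⁺ emb b∈t

  Adj-reflect : ∀ {a b} → Adj J (emb a) b → ∃ λ a′ → b ≡ emb a′ × Adj I a a′
  Adj-reflect {a} {b} (a≢b , R , t , Rt , a∈t , b∈t) =
    retract b , sym b-in-image ,
    (λ e → a≢b (trans (cong emb e) b-in-image)) ,
    R , map retract t , subst T (sym retracted) Rt ,
    subst (_∈ map retract t) (retract∘emb a) (∈-map⁺ retract a∈t) , ∈-map⁺ retract b∈t
    where
    in-image : ∀ c → c ∈ t → emb (retract c) ≡ c
    in-image = closed R t a Rt a∈t
    b-in-image : emb (retract b) ≡ b
    b-in-image = in-image b b∈t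
    retracted : I R (map retract t) ≡ J R t
    retracted = trans (reflects R (map retract t)) (cong (J R) (emb∘retract-on t in-image))

  Dist-emb : ∀ r {a b} → Dist≤ I r a b → Dist≤ J r (emb a) (emb b)
  Dist-emb zero    a≡b                   = cong emb a≡b
  Dist-emb (suc r) (inj₁ d)              = inj₁ (Dist-emb r d)
  Dist-emb (suc r) (inj₂ (c , adj , d)) = inj₂ (emb c , Adj-emb adj , Dist-emb r d)

  Dist-reflect : ∀ r {a b} → Dist≤ J r (emb a) b → ∃ λ a′ → b ≡ emb a′ × Dist≤ I r a a′
  Dist-reflect zero {a} e = a , sym e , refl
  Dist-reflect (suc r) (inj₁ d) with Dist-reflect r d
  ... | a′ , e , d′ = a′ , e , inj₁ d′
  Dist-reflect (suc r) (inj₂ (c , adj , d)) with Adj-reflect adj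
  ... | c′ , refl , adj′ with Dist-reflect r d
  ... | a′ , e , d′ = a′ , e , inj₂ (c′ , adj′ , d′)

  module Centre {n : ℕ} (r : ℕ) (τ : Fin n → Fin (suc m₁)) (z : Fin (suc m₁)) where
    ρ₁ : Fin (suc n) → Fin (suc m₁)
    ρ₁ = ext z τ
    ρ₂ : Fin (suc n) → Fin (suc m₂)
    ρ₂ = ext (emb z) (emb ∘ τ)

    ρ₂≡emb∘ρ₁ : ∀ j → ρ₂ j ≡ emb (ρ₁ j)
    ρ₂≡emb∘ρ₁ zero    = refl
    ρ₂≡emb∘ρ₁ (suc i) = refl

    s₁ : Fin (suc m₁) → Bool
    s₁ = local I r ρ₁
    s₂ : Fin (suc m₂) → Bool
    s₂ = local J r ρ₂

    N₁ N₂ : Set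
    N₁ = Σ (Fin (suc m₁)) (T ∘ s₁)
    N₂ = Σ (Fin (suc m₂)) (T ∘ s₂)

    InLocal-emb : ∀ {a} → InLocal I r ρ₁ a → InLocal J r ρ₂ (emb a)
    InLocal-emb (inj₁ (i , e)) = inj₁ (i , cong emb e)
    InLocal-emb (inj₂ d)       = inj₂ (Dist-emb r d)

    InLocal-reflect : ∀ {b} → InLocal J r ρ₂ b → ∃ λ a → b ≡ emb a × InLocal I r ρ₁ a
    InLocal-reflect (inj₁ (i , e)) = τ i , sym e , inj₁ (i , refl)
    InLocal-reflect (inj₂ d) with Dist-reflect r d
    ... | a , e , d′ = a , e , inj₂ d′

    to : N₁ → N₂
    to (a , p) = emb a , Equivalence.from (local-spec J r ρ₂ (emb a))
                           (InLocal-emb (Equivalence.to (local-spec I r ρ₁ a) p))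

    preimage : (y : N₂) → ∃ λ (x : N₁) → proj₁ y ≡ emb (proj₁ x)
    preimage (b , q) with InLocal-reflect (Equivalence.to (local-spec J r ρ₂ b) q)
    ... | a , e , l = (a , Equivalence.from (local-spec I r ρ₁ a) l) , e

    neighbourhood-↔ : N₁ ↔ N₂
    neighbourhood-↔ = mk↔ₛ′ to (proj₁ ∘ preimage)
      (λ y → subset-≡ _ _ (sym (proj₂ (preimage y))))
      (λ x → subset-≡ _ _ (emb-injective (sym (proj₂ (preimage (to x))))))

    restrict-preserves : ∀ R t → restrict I s₁ R t ≡ restrict J s₂ R (map to t)
    restrict-preserves R t = trans (reflects R (map proj₁ t))
      (cong (J R) (trans (sym (map-∘ emb proj₁ t)) (map-∘ proj₁ to t)))

  local-transfer : ∀ {n} r (θ : Formula σ (suc n)) → Local r θ →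
    (τ : Fin n → Fin (suc m₁)) (z : Fin (suc m₁)) →
    Sat I θ (ext z τ) → Sat J θ (ext (emb z) (emb ∘ τ))
  local-transfer r θ θ-local τ z =
    Equivalence.from (θ-local m₂ J ρ₂ s₂ (local-spec J r ρ₂))
    ∘ Equivalence.to (Sat-↔ (restrict I s₁) (restrict J s₂) neighbourhood-↔ restrict-preserves θ
                        (λ j → subset-≡ _ _ (ρ₂≡emb∘ρ₁ j)))
    ∘ Equivalence.to (θ-local m₁ I ρ₁ s₁ (local-spec I r ρ₁))
    where open Centre r τ z

-- A listing of U is a bijection Fin (suc m) ↔ U; a structure on a listed type is
-- transported to the carrier Fin (suc m) used by the definitions.
listed : ∀ {σ} {U : Set} {m} → Fin (suc m) ↔ U → Rels σ U → Rels σ (Fin (suc m))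
listed E I R t = I R (map (Inverse.to E) t)

Sat-listed : ∀ {σ} {U : Set} {m} (E : Fin (suc m) ↔ U) (I : Rels σ U) (φ : Sentence σ) →
  Sat (listed E I) φ (λ ()) ⇔ Sat I φ (λ ())
Sat-listed E I φ = Sat-↔ (listed E I) I E (λ R t → refl) φ (λ ())

listing-⊎ : ∀ {X Y : Set} {a b} → Fin (suc a) ↔ X → Fin (suc b) ↔ Y → Fin (suc (a + suc b)) ↔ (X ⊎ Y)
listing-⊎ {a = a} {b} E F = ↔-trans (+↔⊎ {suc a} {suc b}) (E ⊎-↔ F)

listing-× : ∀ {X Y : Set} {a b} → Fin (suc a) ↔ X → Fin (suc b) ↔ Y → Fin (suc (b + a * suc b)) ↔ (X × Y)
listing-× {a = a} {b} E F = ↔-trans (*↔× {suc a} {suc b}) (E ×-↔ F)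

degree-by-codes : ∀ {σ} {U : Set} {m c} d (E : Fin (suc m) ↔ U) (I : Rels σ U)
  (code : ∀ x y → Adj I x y → Fin c) →
  (∀ x y y′ p p′ → code x y p ≡ code x y′ p′ → y ≡ y′) → c ≤ d → Degree≤ d (listed E I)
degree-by-codes d E I code separates c≤d a f f-injective adjacent
  with pigeonhole (s≤s c≤d) (λ i → code _ _ (Adj-listed (adjacent i)))
  where
  Adj-listed : ∀ {a b} → Adj (listed E I) a b → Adj I (Inverse.to E a) (Inverse.to E b)
  Adj-listed (a≢b , R , t , Rt , a∈t , b∈t) =
    (a≢b ∘ ↔-injective E) , R , map (Inverse.to E) t , Rt , ∈-map⁺ _ a∈t , ∈-map⁺ _ b∈t
... | i , j , i<j , same = <⇒≢ i<j (f-injective (↔-injective E (separates _ _ _ _ _ same)))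

listed-embedding : ∀ {σ} {U V : Set} {m₁ m₂} {I : Rels σ U} {J : Rels σ V}
  (E₁ : Fin (suc m₁) ↔ U) (E₂ : Fin (suc m₂) ↔ V) →
  ComponentEmbedding I J → ComponentEmbedding (listed E₁ I) (listed E₂ J)
listed-embedding {I = I} {J} E₁ E₂ G = record
  { emb         = from₂ ∘ emb ∘ to₁
  ; retract     = from₁ ∘ retract ∘ to₂
  ; retract∘emb = λ a → trans (cong (from₁ ∘ retract) (to₂∘from₂ _))
                        (trans (cong from₁ (retract∘emb (to₁ a))) (from₁∘to₁ a))
  ; reflects    = λ R t → trans (reflects R (map to₁ t)) (cong (J R) (emb-listed t))
  ; closed      = λ R t a Rt a∈t b b∈t →
      trans (cong (from₂ ∘ emb) (to₁∘from₁ _))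
        (trans (cong from₂ (closed R (map to₂ t) (to₁ a) Rt
                   (subst (_∈ map to₂ t) (to₂∘from₂ _) (∈-map⁺ to₂ a∈t)) (to₂ b) (∈-map⁺ to₂ b∈t)))
          (from₂∘to₂ b))
  }
  where
  open ComponentEmbedding G
  open Inverse E₁ renaming
    (to to to₁; from to from₁; strictlyInverseˡ to to₁∘from₁; strictlyInverseʳ to from₁∘to₁)
  open Inverse E₂ renaming
    (to to to₂; from to from₂; strictlyInverseˡ to to₂∘from₂; strictlyInverseʳ to from₂∘to₂)
  emb-listed : ∀ {k} (t : Vec _ k) → map emb (map to₁ t) ≡ map to₂ (map (from₂ ∘ emb ∘ to₁) t)
  emb-listed t = begin
    map emb (map to₁ t)                   ≡⟨ map-∘ emb to₁ t ⟨
    map (emb ∘ to₁) t                     ≡⟨ map-cong (λ a → sym (to₂∘from₂ (emb (to₁ a)))) t ⟩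
    map (to₂ ∘ from₂ ∘ emb ∘ to₁) t       ≡⟨ map-∘ to₂ (from₂ ∘ emb ∘ to₁) t ⟩
    map to₂ (map (from₂ ∘ emb ∘ to₁) t)   ∎
    where open ≡-Reasoning

listed-automorphism : ∀ {σ} {U : Set} {m} {I : Rels σ U} (E : Fin (suc m) ↔ U) (π : U ↔ U) →
  (∀ R t → I R t ≡ I R (map (Inverse.to π) t)) →
  ∀ R t → listed E I R t ≡ listed E I R (map (Inverse.to (↔-trans E (↔-trans π (↔-sym E)))) t)
listed-automorphism {I = I} E π preserves R t = trans (preserves R (map to t)) (cong (I R) (begin
  map (Inverse.to π) (map to t)         ≡⟨ map-∘ (Inverse.to π) to t ⟨
  map (Inverse.to π ∘ to) t             ≡⟨ map-cong (λ a → sym (strictlyInverseˡ _)) t ⟩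
  map (to ∘ from ∘ Inverse.to π ∘ to) t ≡⟨ map-∘ to (from ∘ Inverse.to π ∘ to) t ⟩
  map to (map (from ∘ Inverse.to π ∘ to) t) ∎))
  where
  open Inverse E
  open ≡-Reasoning

-- The signature: unary P and Root, binary E₀ and E₁ (the two child relations).
σ₀ : Signature
σ₀ = record { #rel = 4 ; arity = λ { zero → 1 ; (suc zero) → 1 ; (suc (suc _)) → 2 } }

P Root : ∀ {k} → Fin k → Formula σ₀ k
P x    = rel zero (x ∷ [])
Root x = rel (suc zero) (x ∷ [])

E : ∀ {k} → Fin 2 → Fin k → Fin k → Formula σ₀ k
E j x y = rel (suc (suc j)) (x ∷ y ∷ [])

-- De Bruijn indices: vᵢ is the variable bound by the i-th innermost quantifier.
v₀ : ∀ {k} → Fin (1 + k)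
v₀ = zero
v₁ : ∀ {k} → Fin (2 + k)
v₁ = suc v₀
v₂ : ∀ {k} → Fin (3 + k)
v₂ = suc v₁
v₃ : ∀ {k} → Fin (4 + k)
v₃ = suc v₂
v₄ : ∀ {k} → Fin (5 + k)
v₄ = suc v₃
v₅ : ∀ {k} → Fin (6 + k)
v₅ = suc v₄

-- S k x y x′ y′ says that x ⇝ y and x′ ⇝ y′ are walks of equal length ≤ 2^k with the
-- same sequence of edge labels.  The step k ↦ k+1 guesses the midpoints v₅, v₄ and
-- uses a single copy of S k, for both halves (x,v₅,x′,v₄) and (v₅,y,v₄,y′), under a
-- universal quantification ∀v₃ v₂ v₁ v₀; so |S k| grows linearly in k.
S : ∀ {k} → ℕ → Fin k → Fin k → Fin k → Fin k → Formula σ₀ k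
S zero x y x′ y′ =
  or (and (eq x y) (eq x′ y′)) (or (and (E zero x y) (E zero x′ y′)) (and (E (suc zero) x y) (E (suc zero) x′ y′)))
S (suc k) x y x′ y′ = ex (ex (all (all (all (all
  (or (neg (or (and (eq v₃ (↑ x)) (and (eq v₂ v₅) (and (eq v₁ (↑ x′)) (eq v₀ v₄))))
               (and (eq v₃ v₅) (and (eq v₂ (↑ y)) (and (eq v₁ v₄) (eq v₀ (↑ y′)))))))
      (S k v₃ v₂ v₁ v₀)))))))
  where
  ↑ : ∀ {k} → Fin k → Fin (6 + k)
  ↑ x = suc (suc (suc (suc (suc (suc x)))))

size-S : ∀ {k} K (x y x′ y′ : Fin k) → size (S K x y x′ y′) ≡ 45 + K * 61
size-S zero    x y x′ y′ = refl
size-S (suc K) x y x′ y′ = cong (61 +_) (size-S K _ _ _ _)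

-- φ K: there are no two distinct roots v₁, v₀ such that any two nodes reached from
-- them along the same label sequence (of length ≤ 2^K) agree on P.
φ : ℕ → Sentence σ₀
φ K = neg (ex (ex (and (and (Root v₁) (Root v₀)) (and (neg (eq v₁ v₀))
  (all (all (or (neg (S K v₃ v₁ v₂ v₀)) (and (or (neg (P v₁)) (P v₀)) (or (neg (P v₀)) (P v₁))))))))))

size-φ : ∀ K → size (φ K) ≡ 106 + K * 61
size-φ K = begin
  size (φ K)         ≡⟨ cong (λ n → 34 + n + 27) (size-S K _ _ _ _) ⟩
  79 + K * 61 + 27   ≡⟨ cong (79 +_) (+-comm (K * 61) 27) ⟩
  106 + K * 61       ∎
  where open ≡-Reasoning

-- The meaning of S in a σ₀-structure (with decidable equality, needed to verify the
-- universal quantification over the two halves).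
module Synchronised {U : Set} (_≟_ : DecidableEquality U) (I : Rels σ₀ U) where

  Edge : Fin 2 → U → U → Set
  Edge j a b = T (I (suc (suc j)) (a ∷ b ∷ []))

  Sync : ℕ → U → U → U → U → Set
  Sync zero a b a′ b′ =
    (a ≡ b × a′ ≡ b′) ⊎ (Edge zero a b × Edge zero a′ b′) ⊎ (Edge (suc zero) a b × Edge (suc zero) a′ b′)
  Sync (suc k) a b a′ b′ = ∃₂ λ c c′ → Sync k a c a′ c′ × Sync k c b c′ b′

  Sat-S : ∀ {n} k (x y x′ y′ : Fin n) (ρ : Fin n → U) →
    Sat I (S k x y x′ y′) ρ ⇔ Sync k (ρ x) (ρ y) (ρ x′) (ρ y′)
  Sat-S zero    x y x′ y′ ρ = mk⇔ id id
  Sat-S {n} (suc k) x y x′ y′ ρ = mk⇔ split join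
    where
    split : Sat I (S (suc k) x y x′ y′) ρ → Sync (suc k) (ρ x) (ρ y) (ρ x′) (ρ y′)
    split (c , c′ , H) = c , c′ , half (H (ρ x) c (ρ x′) c′) (inj₁ (refl , refl , refl , refl))
                                , half (H c (ρ y) c′ (ρ y′)) (inj₂ (refl , refl , refl , refl))
      where
      half : ∀ {ρ′ : Fin (6 + n) → U} {A : Set} → (¬ A ⊎ Sat I (S k v₃ v₂ v₁ v₀) ρ′) → A →
        Sync k (ρ′ v₃) (ρ′ v₂) (ρ′ v₁) (ρ′ v₀)
      half (inj₁ ¬chosen) chosen = ⊥-elim (¬chosen chosen)
      half (inj₂ s)       _      = Equivalence.to (Sat-S k v₃ v₂ v₁ v₀ _) s
    join : Sync (suc k) (ρ x) (ρ y) (ρ x′) (ρ y′) → Sat I (S (suc k) x y x′ y′) ρ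
    join (c , c′ , first , second) = c , c′ , check
      where
      check : ∀ a b a′ b′ →
        ¬ ((a ≡ ρ x × b ≡ c × a′ ≡ ρ x′ × b′ ≡ c′) ⊎ (a ≡ c × b ≡ ρ y × a′ ≡ c′ × b′ ≡ ρ y′))
        ⊎ Sat I (S k v₃ v₂ v₁ v₀) (ext b′ (ext a′ (ext b (ext a (ext c′ (ext c ρ))))))
      check a b a′ b′ with (a ≟ ρ x ×-dec (b ≟ c ×-dec (a′ ≟ ρ x′ ×-dec b′ ≟ c′)))
                     ⊎-dec (a ≟ c ×-dec (b ≟ ρ y ×-dec (a′ ≟ c′ ×-dec b′ ≟ ρ y′)))
      ... | yes (inj₁ (refl , refl , refl , refl)) = inj₂ (Equivalence.from (Sat-S k v₃ v₂ v₁ v₀ _) first)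
      ... | yes (inj₂ (refl , refl , refl , refl)) = inj₂ (Equivalence.from (Sat-S k v₃ v₂ v₁ v₀ _) second)
      ... | no ¬chosen = inj₁ ¬chosen

data Node : ℕ → Set where
  root : ∀ {D} → Node D
  ch   : ∀ {D} → Fin 2 → Node D → Node (suc D)

_≟N_ : ∀ {D} → DecidableEquality (Node D)
root   ≟N root     = yes refl
root   ≟N ch _ _   = no λ ()
ch _ _ ≟N root     = no λ ()
ch i w ≟N ch i′ w′ with i ≟ i′ | w ≟N w′
... | yes refl | yes refl = yes refl
... | no i≢i′  | _        = no λ { refl → i≢i′ refl }
... | _        | no w≢w′  = no λ { refl → w≢w′ refl }

data Child (j : Fin 2) : ∀ {D} → Node D → Node D → Set where
  first : ∀ {D} → Child j {suc D} root (ch j root)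
  later : ∀ {D i w v} → Child j {D} w v → Child j (ch i w) (ch i v)

child? : ∀ {D} j (w v : Node D) → Dec (Child j w v)
child? j root     root            = no λ ()
child? j root     (ch i root)     = Dec.map′ (λ { refl → first }) (λ { first → refl }) (j ≟ i)
child? j root     (ch i (ch _ _)) = no λ ()
child? j (ch i w) root            = no λ ()
child? j (ch i w) (ch i′ v) with i ≟ i′
... | yes refl = Dec.map′ later (λ { (later c) → c }) (child? j w v)
... | no i≢i′  = no λ { (later _) → i≢i′ refl }

child-functional : ∀ {D j} {w v v′ : Node D} → Child j w v → Child j w v′ → v ≡ v′
child-functional first     first      = refl
child-functional (later c) (later c′) = cong (ch _) (child-functional c c′)

parent-unique : ∀ {D j j′} {w w′ v : Node D} → Child j w v → Child j′ w′ v → w ≡ w′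
parent-unique first     first      = refl
parent-unique (later c) (later c′) = cong (ch _) (parent-unique c c′)

data Path {D : ℕ} : ℕ → Node D → Node D → Set where
  done : ∀ {w} → Path 0 w w
  step : ∀ {l w u v} j → Child j w u → Path l u v → Path (suc l) w v

path-lift : ∀ {D l} i {w v : Node D} → Path l w v → Path l (ch i w) (ch i v)
path-lift i done         = done
path-lift i (step j c p) = step j (later c) (path-lift i p)

root-reaches : ∀ {D} (w : Node D) → ∃ λ l → l ≤ D × Path l root w
root-reaches root     = 0 , z≤n , done
root-reaches (ch i w) with root-reaches w
... | l , l≤D , p = suc l , s≤s l≤D , step i first (path-lift i p)

path-split : ∀ {D} l₁ l₂ {w v : Node D} → Path (l₁ + l₂) w v → ∃ λ u → Path l₁ w u × Path l₂ u v
path-split zero     l₂ p            = _ , done , p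
path-split (suc l₁) l₂ (step j c p) with path-split l₁ l₂ p
... | u , p₁ , p₂ = u , step j c p₁ , p₂

halve : ∀ k l → l ≤ 2 ^ suc k → ∃₂ λ l₁ l₂ → l ≡ l₁ + l₂ × l₁ ≤ 2 ^ k × l₂ ≤ 2 ^ k
halve k l l≤ with l ≤? 2 ^ k
... | yes l≤half = l , 0 , sym (+-identityʳ l) , l≤half , z≤n
... | no  l≰half = 2 ^ k , l ∸ 2 ^ k , sym (m+[n∸m]≡n (<⇒≤ (≰⇒> l≰half))) , ≤-refl , rest≤half
  where
  rest≤half : l ∸ 2 ^ k ≤ 2 ^ k
  rest≤half = subst (l ∸ 2 ^ k ≤_) (m+n∸m≡n (2 ^ k) (2 ^ k))
    (∸-monoˡ-≤ (2 ^ k) (subst (l ≤_) (cong (2 ^ k +_) (+-identityʳ (2 ^ k))) l≤))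

-- The biconditional a ↔ b of truth values, spelt with ¬, ∨, ∧ as in φ.
Agree : Bool → Bool → Set
Agree a b = (¬ T a ⊎ T b) × (¬ T b ⊎ T a)

T-agree : ∀ {a b} → Agree a b → a ≡ b
T-agree {false} {false} _                = refl
T-agree {true}  {true}  _                = refl
T-agree {false} {true}  (_ , inj₁ ¬b)    = ⊥-elim (¬b tt)
T-agree {true}  {false} (inj₁ ¬a , _)    = ⊥-elim (¬a tt)

T-agree⁻ : ∀ {a b} → a ≡ b → Agree a b
T-agree⁻ {false} refl = inj₁ (λ ()) , inj₁ (λ ())
T-agree⁻ {true}  refl = inj₂ tt , inj₂ tt

∈-pair : ∀ {A : Set} {x p q : A} → x ∈ p ∷ q ∷ [] → x ≡ p ⊎ x ≡ q
∈-pair (here x≡p)         = inj₁ x≡p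
∈-pair (there (here x≡q)) = inj₂ x≡q

-- A forest: one copy of the binary tree of depth D for every component k : C, each
-- node w of copy k carrying the label P = lab k w; E_j is the j-child relation inside a copy.
module Forest {D : ℕ} {C : Set} (_≟C_ : DecidableEquality C) (lab : C → Node D → Bool) where

  Elem : Set
  Elem = C × Node D

  _≟E_ : DecidableEquality Elem
  _≟E_ = Productₚ.≡-dec _≟C_ _≟N_

  Str : Rels σ₀ Elem
  Str zero          ((k , w) ∷ [])            = lab k w
  Str (suc zero)    ((k , w) ∷ [])            = ⌊ w ≟N root ⌋
  Str (suc (suc j)) ((k , w) ∷ (k′ , v) ∷ []) = ⌊ (k ≟C k′) ×-dec child? j w v ⌋

  open Synchronised _≟E_ Str public

  sync-path : ∀ K {l w v} k₁ k₂ → Path l w v → l ≤ 2 ^ K → Sync K (k₁ , w) (k₁ , v) (k₂ , w) (k₂ , v)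
  sync-path zero k₁ k₂ done                          _ = inj₁ (refl , refl)
  sync-path zero k₁ k₂ (step zero c done)            _ = inj₂ (inj₁ (fromWitness (refl , c) , fromWitness (refl , c)))
  sync-path zero k₁ k₂ (step (suc zero) c done)      _ = inj₂ (inj₂ (fromWitness (refl , c) , fromWitness (refl , c)))
  sync-path zero k₁ k₂ (step _ _ (step _ _ _)) (s≤s ())
  sync-path (suc K) {l} k₁ k₂ p l≤ with halve K l l≤
  ... | l₁ , l₂ , refl , l₁≤ , l₂≤ with path-split l₁ l₂ p
  ... | u , p₁ , p₂ = (k₁ , u) , (k₂ , u) , sync-path K k₁ k₂ p₁ l₁≤ , sync-path K k₁ k₂ p₂ l₂≤

  -- Twins: the same node in two copies carrying the same labelling.
  -- Synchronous walks stay inside their copies, so they preserve being twins.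
  Twins : Elem → Elem → Set
  Twins (k , w) (k′ , w′) = w ≡ w′ × (∀ u → lab k u ≡ lab k′ u)

  twins-step : ∀ j {a b a′ b′} → Edge j a b → Edge j a′ b′ → Twins a a′ → Twins b b′
  twins-step j e e′ (refl , same) with toWitness e | toWitness e′
  ... | refl , c | refl , c′ = child-functional c c′ , same

  sync-twins : ∀ K {a b a′ b′} → Sync K a b a′ b′ → Twins a a′ → Twins b b′
  sync-twins zero (inj₁ (refl , refl))      t = t
  sync-twins zero (inj₂ (inj₁ (e , e′)))    t = twins-step zero e e′ t
  sync-twins zero (inj₂ (inj₂ (e , e′)))    t = twins-step (suc zero) e e′ t
  sync-twins (suc K) (_ , _ , s₁ , s₂)      t = sync-twins K s₂ (sync-twins K s₁ t)

  φ-holds : ∀ K → D ≤ 2 ^ K → (∀ k k′ → (∀ u → lab k u ≡ lab k′ u) → k ≡ k′) → Sat Str (φ K) (λ ())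
  φ-holds K D≤ distinct ((k₁ , w₁) , (k₂ , w₂) , (root₁ , root₂) , k≢ , agree)
    with toWitness root₁ | toWitness root₂
  ... | refl | refl = k≢ (cong (_, root) (distinct k₁ k₂ same-label))
    where
    same-label : ∀ w → lab k₁ w ≡ lab k₂ w
    same-label w with root-reaches w | agree (k₁ , w) (k₂ , w)
    ... | l , l≤D , p | inj₁ ¬sync =
      ⊥-elim (¬sync (Equivalence.from (Sat-S K _ _ _ _ _) (sync-path K k₁ k₂ p (≤-trans l≤D D≤))))
    ... | _ | inj₂ P-agree = T-agree P-agree

  φ-fails : ∀ K {k k′} → k ≢ k′ → (∀ u → lab k u ≡ lab k′ u) → ¬ Sat Str (φ K) (λ ())
  φ-fails K {k} {k′} k≢k′ same no-twins =
    no-twins ((k , root) , (k′ , root) , (tt , tt) , k≢k′ ∘ cong proj₁ , agree)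
    where
    agree : ∀ x x′ → ¬ Sat Str (S K v₃ v₁ v₂ v₀) (ext x′ (ext x (ext (k′ , root) (ext (k , root) (λ ())))))
                     ⊎ Agree (lab (proj₁ x) (proj₂ x)) (lab (proj₁ x′) (proj₂ x′))
    agree (l , u) (l′ , u′) with lab l u Boolₚ.≟ lab l′ u′
    ... | yes P-same = inj₂ (T-agree⁻ P-same)
    ... | no  P-diff = inj₁ λ s → P-diff (twins-label (sync-twins K (Equivalence.to (Sat-S K _ _ _ _ _) s) (refl , same)))
      where
      twins-label : Twins (l , u) (l′ , u′) → lab l u ≡ lab l′ u′
      twins-label (refl , same′) = same′ u

  same-component : ∀ R t → T (Str R t) → ∀ {x y} → x ∈ t → y ∈ t → proj₁ x ≡ proj₁ y
  same-component zero          (_ ∷ []) _ (here refl) (here refl) = refl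
  same-component (suc zero)    (_ ∷ []) _ (here refl) (here refl) = refl
  same-component (suc (suc j)) (p ∷ q ∷ []) Rt x∈ y∈ with toWitness Rt | ∈-pair x∈ | ∈-pair y∈
  ... | pq , _ | inj₁ refl | inj₁ refl = refl
  ... | pq , _ | inj₁ refl | inj₂ refl = pq
  ... | pq , _ | inj₂ refl | inj₁ refl = sym pq
  ... | pq , _ | inj₂ refl | inj₂ refl = refl

  data Neighbour (x : Elem) : Elem → Set where
    parent : ∀ {j v} → Child j v (proj₂ x) → Neighbour x (proj₁ x , v)
    child  : ∀ j {v} → Child j (proj₂ x) v → Neighbour x (proj₁ x , v)

  neighbour : ∀ {x y} → Adj Str x y → Neighbour x y
  neighbour (x≢y , zero       , _ ∷ [] , _ , here refl , here refl) = ⊥-elim (x≢y refl)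
  neighbour (x≢y , suc zero   , _ ∷ [] , _ , here refl , here refl) = ⊥-elim (x≢y refl)
  neighbour (x≢y , suc (suc j) , p ∷ q ∷ [] , Rt , x∈ , y∈) with toWitness Rt | ∈-pair x∈ | ∈-pair y∈
  ... | refl , c | inj₁ refl | inj₂ refl = child j c
  ... | refl , c | inj₂ refl | inj₁ refl = parent c
  ... | _        | inj₁ refl | inj₁ refl = ⊥-elim (x≢y refl)
  ... | _        | inj₂ refl | inj₂ refl = ⊥-elim (x≢y refl)

  position : ∀ {x y} → Neighbour x y → Fin 3
  position (parent _)  = zero
  position (child j _) = suc j

  position-separates : ∀ {x y y′} (n : Neighbour x y) (n′ : Neighbour x y′) → position n ≡ position n′ → y ≡ y′
  position-separates (parent c)  (parent c′)   _    = cong (_ ,_) (parent-unique c c′)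
  position-separates (child j c) (child .j c′) refl = cong (_ ,_) (child-functional c c′)

  degree≤ : ∀ {m} d (E : Fin (suc m) ↔ Elem) → 3 ≤ d → Degree≤ d (listed E Str)
  degree≤ d E = degree-by-codes d E Str (λ _ _ → position ∘ neighbour)
    (λ _ _ _ p p′ → position-separates (neighbour p) (neighbour p′))

module ForestMap {D : ℕ} {C C′ : Set} (_≟C_ : DecidableEquality C) (_≟C′_ : DecidableEquality C′)
    (lab : C → Node D → Bool) (lab′ : C′ → Node D → Bool)
    (ι : C → C′) (ι-injective : ∀ {k k′} → ι k ≡ ι k′ → k ≡ k′)
    (lab′∘ι : ∀ k u → lab′ (ι k) u ≡ lab k u) where

  private
    module F  = Forest _≟C_ lab
    module F′ = Forest _≟C′_ lab′

  Str-natural : ∀ R t → F.Str R t ≡ F′.Str R (map (map₁ ι) t)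
  Str-natural zero          ((k , w) ∷ [])            = sym (lab′∘ι k w)
  Str-natural (suc zero)    (_ ∷ [])                  = refl
  Str-natural (suc (suc j)) ((k , w) ∷ (k′ , v) ∷ []) =
    trans (isYes≗does _) (trans (does-⇔ same-edge edge? edge′?) (sym (isYes≗does _)))
    where
    same-edge : (k ≡ k′ × Child j w v) ⇔ (ι k ≡ ι k′ × Child j w v)
    same-edge = mk⇔ (map₁ (cong ι)) (map₁ ι-injective)
    edge? : Dec (k ≡ k′ × Child j w v)
    edge? = (k ≟C k′) ×-dec child? j w v
    edge′? : Dec (ι k ≡ ι k′ × Child j w v)
    edge′? = (ι k ≟C′ ι k′) ×-dec child? j w v

  component-embedding : (ret : C′ → C) → (∀ k → ret (ι k) ≡ k) → ComponentEmbedding F.Str F′.Str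
  component-embedding ret ret∘ι = record
    { emb         = map₁ ι
    ; retract     = map₁ ret
    ; retract∘emb = λ (k , w) → cong (_, w) (ret∘ι k)
    ; reflects    = Str-natural
    ; closed      = λ R t a Rt a∈t b b∈t → in-image b (F′.same-component R t Rt b∈t a∈t)
    }
    where
    in-image : ∀ b {k} → proj₁ b ≡ ι k → map₁ ι (map₁ ret b) ≡ b
    in-image (_ , w) {k} refl = cong (λ c → ι c , w) (ret∘ι k)

missed-value : ∀ {n M} → n < M → (f : Fin n → Fin M) → ∃ λ y → ∀ i → f i ≢ y
missed-value {n} {M} n<M f with ¬∀⟶∃¬ M (λ y → ∃ λ i → f i ≡ y) (λ y → any? (λ i → f i ≟ y)) not-onto
  where
  not-onto : ¬ (∀ y → ∃ λ i → f i ≡ y)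
  not-onto onto = <⇒≱ n<M (injective⇒≤ {f = proj₁ ∘ onto}
    (λ {y} {y′} same → trans (sym (proj₂ (onto y))) (trans (cong f same) (proj₂ (onto y′)))))
... | y , unhit = y , λ i hit → unhit (i , hit)

-- Listings of nodes, labellings and optional values.  Node D has suc (nodes⁻ D)
-- elements and Vec Bool s has suc (labellings⁻ s) = 2 ^ s elements.
nodes⁻ : ℕ → ℕ
nodes⁻ zero    = 0
nodes⁻ (suc D) = 0 + suc (nodes⁻ D + 1 * suc (nodes⁻ D))

listing-Node : ∀ D → Fin (suc (nodes⁻ D)) ↔ Node D
listing-Node zero    = mk↔ₛ′ (λ _ → root) (λ _ → zero) (λ { root → refl }) (λ { zero → refl })
listing-Node (suc D) = ↔-trans (listing-⊎ 1↔⊤ (listing-× ↔-refl (listing-Node D))) split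
  where
  split : (⊤ ⊎ (Fin 2 × Node D)) ↔ Node (suc D)
  split = mk↔ₛ′ (λ { (inj₁ _) → root ; (inj₂ (j , w)) → ch j w })
                (λ { root → inj₁ tt ; (ch j w) → inj₂ (j , w) })
                (λ { root → refl ; (ch j w) → refl })
                (λ { (inj₁ _) → refl ; (inj₂ _) → refl })

labellings⁻ : ℕ → ℕ
labellings⁻ zero    = 0
labellings⁻ (suc s) = labellings⁻ s + 1 * suc (labellings⁻ s)

listing-Vec : ∀ s → Fin (suc (labellings⁻ s)) ↔ Vec Bool s
listing-Vec zero    = mk↔ₛ′ (λ _ → []) (λ _ → zero) (λ { [] → refl }) (λ { zero → refl })
listing-Vec (suc s) = ↔-trans (listing-× 2↔Bool (listing-Vec s))
  (mk↔ₛ′ (uncurry _∷_) (λ { (b ∷ v) → b , v }) (λ { (b ∷ v) → refl }) (λ _ → refl))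

listing-Maybe : ∀ {X : Set} {a} → Fin (suc a) ↔ X → Fin (suc (0 + suc a)) ↔ Maybe X
listing-Maybe E = ↔-trans (listing-⊎ 1↔⊤ E)
  (mk↔ₛ′ (λ { (inj₁ _) → nothing ; (inj₂ x) → just x }) (λ { nothing → inj₁ tt ; (just x) → inj₂ x })
         (λ { nothing → refl ; (just x) → refl }) (λ { (inj₁ _) → refl ; (inj₂ _) → refl }))

#labellings : ∀ s → suc (labellings⁻ s) ≡ 2 ^ s
#labellings zero    = refl
#labellings (suc s) = cong (2 *_) (#labellings s)

#nodes : ∀ D → 2 ^ D ≤ suc (nodes⁻ D)
#nodes zero    = ≤-refl
#nodes (suc D) = ≤-trans (+-mono-≤ (#nodes D) (+-mono-≤ (#nodes D) z≤n)) (n≤1+n _)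

-- The structures 𝔄 and 𝔅 c₀ for the sentence φ K.  Trees have depth D = 2 ^ K and
-- s nodes; a labelling is a vector of s bits, read through the listing of the nodes.
module Duplication (K : ℕ) where

  D : ℕ
  D = 2 ^ K

  s : ℕ
  s = suc (nodes⁻ D)

  Labelling : Set
  Labelling = Vec Bool s

  label : Labelling → Node D → Bool
  label c w = lookup c (Inverse.from (listing-Node D) w)

  label-injective : ∀ c c′ → (∀ u → label c u ≡ label c′ u) → c ≡ c′
  label-injective c c′ same = begin
    c                      ≡⟨ tabulate∘lookup c ⟨
    tabulate (lookup c)    ≡⟨ tabulate-cong agree ⟩
    tabulate (lookup c′)   ≡⟨ tabulate∘lookup c′ ⟩
    c′                     ∎
    where
    open ≡-Reasoning
    open Inverse (listing-Node D) using (to; strictlyInverseʳ)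
    agree : ∀ i → lookup c i ≡ lookup c′ i
    agree i = subst (λ j → lookup c j ≡ lookup c′ j) (strictlyInverseʳ i) (same (to i))

  _≟L_ : DecidableEquality Labelling
  _≟L_ = Vecₚ.≡-dec Boolₚ._≟_

  _≟M_ : DecidableEquality (Maybe Labelling)
  _≟M_ = Maybeₚ.≡-dec _≟L_

  module A = Forest _≟L_ label

  mA : ℕ
  mA = nodes⁻ D + labellings⁻ s * s

  EA : Fin (suc mA) ↔ (Labelling × Node D)
  EA = listing-× (listing-Vec s) (listing-Node D)

  𝔄 : Rels σ₀ (Fin (suc mA))
  𝔄 = listed EA A.Str

  -- 𝔅 c₀: 𝔄 together with a second tree labelled c₀, the copy nothing.
  module B (c₀ : Labelling) = Forest _≟M_ (label ∘ fromMaybe c₀)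

  mB : ℕ
  mB = nodes⁻ D + (0 + suc (labellings⁻ s)) * s

  EB : Fin (suc mB) ↔ (Maybe Labelling × Node D)
  EB = listing-× (listing-Maybe (listing-Vec s)) (listing-Node D)

  𝔅 : Labelling → Rels σ₀ (Fin (suc mB))
  𝔅 c₀ = listed EB (B.Str c₀)

  𝔄⊨φ : Sat 𝔄 (φ K) (λ ())
  𝔄⊨φ = Equivalence.from (Sat-listed EA A.Str (φ K)) (A.φ-holds K ≤-refl label-injective)

  𝔅⊭φ : ∀ c₀ → ¬ Sat (𝔅 c₀) (φ K) (λ ())
  𝔅⊭φ c₀ = B.φ-fails c₀ K {nothing} {just c₀} (λ ()) (λ _ → refl)
           ∘ Equivalence.to (Sat-listed EB (B.Str c₀) (φ K))

  embedding : ∀ c₀ → ComponentEmbedding 𝔄 (𝔅 c₀)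
  embedding c₀ = listed-embedding EA EB
    (ForestMap.component-embedding _≟L_ _≟M_ label (label ∘ fromMaybe c₀) just Maybeₚ.just-injective
       (λ _ _ → refl) (fromMaybe c₀) (λ _ → refl))

  swap : Labelling → Maybe Labelling → Maybe Labelling
  swap c₀ nothing  = just c₀
  swap c₀ (just c) with c ≟L c₀
  ... | yes _ = nothing
  ... | no  _ = just c

  swap-fixes : ∀ c₀ {c} → c ≢ c₀ → swap c₀ (just c) ≡ just c
  swap-fixes c₀ {c} c≢c₀ rewrite dec-no (c ≟L c₀) c≢c₀ = refl

  swap-moves : ∀ c₀ → swap c₀ (just c₀) ≡ nothing
  swap-moves c₀ with c₀ ≟L c₀
  ... | yes _    = refl
  ... | no c₀≢c₀ = ⊥-elim (c₀≢c₀ refl)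

  swap-involutive : ∀ c₀ x → swap c₀ (swap c₀ x) ≡ x
  swap-involutive c₀ nothing  = swap-moves c₀
  swap-involutive c₀ (just c) with c ≟L c₀
  ... | yes refl = refl
  ... | no c≢c₀  = swap-fixes c₀ c≢c₀

  swap-labels : ∀ c₀ x → fromMaybe c₀ (swap c₀ x) ≡ fromMaybe c₀ x
  swap-labels c₀ nothing  = refl
  swap-labels c₀ (just c) with c ≟L c₀
  ... | yes refl = refl
  ... | no  _    = refl

  swap-↔ : Labelling → (Maybe Labelling × Node D) ↔ (Maybe Labelling × Node D)
  swap-↔ c₀ = mk↔ₛ′ (map₁ (swap c₀)) (map₁ (swap c₀)) involutive involutive
    where
    involutive : ∀ x → map₁ (swap c₀) (map₁ (swap c₀) x) ≡ x
    involutive (k , w) = cong (_, w) (swap-involutive c₀ k)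

  swap-automorphism : ∀ c₀ R t → B.Str c₀ R t ≡ B.Str c₀ R (map (map₁ (swap c₀)) t)
  swap-automorphism c₀ = ForestMap.Str-natural _≟M_ _≟M_ (label ∘ fromMaybe c₀) (label ∘ fromMaybe c₀)
    (swap c₀) swap-injective (λ k u → cong (λ c → label c u) (swap-labels c₀ k))
    where
    swap-injective : ∀ {x y} → swap c₀ x ≡ swap c₀ y → x ≡ y
    swap-injective {x} {y} e = trans (sym (swap-involutive c₀ x)) (trans (cong (swap c₀) e) (swap-involutive c₀ y))

  module Witnesses (c₀ : Labelling) {n r} (θ : Formula σ₀ (suc n)) (θ-local : Local r θ)
      (τ : Fin n → Fin (suc mA))
      (fresh : ∀ i → proj₁ (Inverse.to EA (τ i)) ≢ c₀) where

    open ComponentEmbedding (embedding c₀) using (emb)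
    open ComponentTransfer (embedding c₀) using (local-transfer)
    open Inverse EB using () renaming
      (to to toB; from to fromB; strictlyInverseˡ to toB∘fromB; strictlyInverseʳ to fromB∘toB)

    emb-from : ∀ c w → emb (Inverse.from EA (c , w)) ≡ fromB (just c , w)
    emb-from c w = cong (fromB ∘ map₁ just) (Inverse.strictlyInverseˡ EA (c , w))

    π : Fin (suc mB) ↔ Fin (suc mB)
    π = ↔-trans EB (↔-trans (swap-↔ c₀) (↔-sym EB))

    π-from : ∀ x → Inverse.to π (fromB x) ≡ fromB (map₁ (swap c₀) x)
    π-from x = cong (fromB ∘ map₁ (swap c₀)) (toB∘fromB x)

    π-fixes : ∀ i → Inverse.to π (emb (τ i)) ≡ emb (τ i)
    π-fixes i = trans (π-from (just c , w)) (cong (λ k → fromB (k , w)) (swap-fixes c₀ (fresh i)))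
      where
      c : Labelling
      c = proj₁ (Inverse.to EA (τ i))
      w : Node D
      w = proj₂ (Inverse.to EA (τ i))

    everywhere : (∀ z → Sat 𝔄 θ (ext z τ)) → ∀ z′ → Sat (𝔅 c₀) θ (ext z′ (emb ∘ τ))
    everywhere ∀z z′ with toB z′ in z′-is
    ... | just c , w = Sat-ext (𝔅 c₀) θ at-z′ (local-transfer r θ θ-local τ a (∀z a))
      where
      a : Fin (suc mA)
      a = Inverse.from EA (c , w)
      at-z′ : ∀ j → ext z′ (emb ∘ τ) j ≡ ext (emb a) (emb ∘ τ) j
      at-z′ zero    = sym (trans (emb-from c w) (trans (cong fromB (sym z′-is)) (fromB∘toB z′)))
      at-z′ (suc i) = refl
    ... | nothing , w = Equivalence.to
      (Sat-↔ (𝔅 c₀) (𝔅 c₀) π (listed-automorphism EB (swap-↔ c₀) (swap-automorphism c₀)) θ swapped)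
      (local-transfer r θ θ-local τ a (∀z a))
      where
      a : Fin (suc mA)
      a = Inverse.from EA (c₀ , w)
      swapped : ∀ j → ext z′ (emb ∘ τ) j ≡ Inverse.to π (ext (emb a) (emb ∘ τ) j)
      swapped zero    = sym (begin
        Inverse.to π (emb a)                ≡⟨ cong (Inverse.to π) (emb-from c₀ w) ⟩
        Inverse.to π (fromB (just c₀ , w))  ≡⟨ π-from (just c₀ , w) ⟩
        fromB (swap c₀ (just c₀) , w)       ≡⟨ cong (λ k → fromB (k , w)) (swap-moves c₀) ⟩
        fromB (nothing , w)                 ≡⟨ cong fromB z′-is ⟨
        fromB (toB z′)                      ≡⟨ fromB∘toB z′ ⟩
        z′                                  ∎)
        where open ≡-Reasoning
      swapped (suc i) = sym (π-fixes i)

  duplicate : ∀ n r (θ : Formula σ₀ (suc (n + 0))) → Local r θ → n < 2 ^ s →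
    Sat 𝔄 (exs n (all θ)) (λ ()) → ∃ λ c₀ → Sat (𝔅 c₀) (exs n (all θ)) (λ ())
  duplicate n r θ θ-local n<2^s 𝔄⊨ψ = c₀ , 𝔅⊨ψ
    where
    LV : Fin (suc (labellings⁻ s)) ↔ Labelling
    LV = listing-Vec s
    witnesses : Σ (Fin (n + 0) → Fin (suc mA)) (Sat 𝔄 (all θ))
    witnesses = Sat-exs⁻ 𝔄 n (all θ) (λ ()) 𝔄⊨ψ
    τ : Fin (n + 0) → Fin (suc mA)
    τ = proj₁ witnesses
    unused : ∃ λ code → ∀ i → Inverse.from LV (proj₁ (Inverse.to EA (τ i))) ≢ code
    unused = missed-value (subst₂ _<_ (sym (+-identityʳ n)) (sym (#labellings s)) n<2^s) _
    c₀ : Labelling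
    c₀ = Inverse.to LV (proj₁ unused)
    fresh : ∀ i → proj₁ (Inverse.to EA (τ i)) ≢ c₀
    fresh i same = proj₂ unused i (trans (cong (Inverse.from LV) same) (Inverse.strictlyInverseʳ LV _))
    𝔅⊨ψ : Sat (𝔅 c₀) (exs n (all θ)) (λ ())
    𝔅⊨ψ = Sat-ext (𝔅 c₀) (exs n (all θ)) (λ ())
      (Sat-exs⁺ (𝔅 c₀) n (all θ) _ (Witnesses.everywhere c₀ θ θ-local τ fresh (proj₂ witnesses)))

n≤2^n : ∀ n → n ≤ 2 ^ n
n≤2^n zero    = z≤n
n≤2^n (suc n) = +-mono-≤ (m^n>0 2 n) (subst (n ≤_) (sym (+-identityʳ (2 ^ n))) (n≤2^n n))

size-linear : ∀ d h → 1 ≤ h → size (φ (d + h)) ≤ (106 + d * 61 + 61) * h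
size-linear d (suc h) _ = begin
  size (φ (d + suc h))                        ≡⟨ size-φ (d + suc h) ⟩
  106 + (d + suc h) * 61                      ≡⟨ cong (106 +_) (*-distribʳ-+ 61 d (suc h)) ⟩
  106 + (d * 61 + suc h * 61)                 ≡⟨ +-assoc 106 (d * 61) (suc h * 61) ⟨
  (106 + d * 61) + suc h * 61                 ≤⟨ +-mono-≤ (m≤m*n (106 + d * 61) (suc h))
                                                            (≤-reflexive (*-comm (suc h) 61)) ⟩
  (106 + d * 61) * suc h + 61 * suc h         ≡⟨ *-distribʳ-+ (suc h) (106 + d * 61) 61 ⟨
  (106 + d * 61 + 61) * suc h                 ∎
  where open ≤-Reasoning

many-nodes : ∀ d h → (d ∸ 1) ^ (2 ^ h) ≤ suc (nodes⁻ (2 ^ (d + h)))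
many-nodes d h = begin
  (d ∸ 1) ^ (2 ^ h)        ≤⟨ ^-monoˡ-≤ (2 ^ h) d-1≤2^2^d ⟩
  (2 ^ (2 ^ d)) ^ (2 ^ h)  ≡⟨ ^-*-assoc 2 (2 ^ d) (2 ^ h) ⟩
  2 ^ (2 ^ d * 2 ^ h)      ≡⟨ cong (2 ^_) (^-distribˡ-+-* 2 d h) ⟨
  2 ^ (2 ^ (d + h))        ≤⟨ #nodes (2 ^ (d + h)) ⟩
  suc (nodes⁻ (2 ^ (d + h))) ∎
  where
  open ≤-Reasoning
  d-1≤2^2^d : d ∸ 1 ≤ 2 ^ (2 ^ d)
  d-1≤2^2^d = ≤-trans (m∸n≤m d 1) (≤-trans (n≤2^n d) (^-monoʳ-≤ 2 (n≤2^n d)))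

theorem14 : (d : ℕ) → 3 ≤ d →
    Σ Signature (λ σ → Σ (ℕ → Sentence σ) (λ φ →
      Σ ℕ (λ C → (h : ℕ) → 1 ≤ h → size (φ h) ≤ C * h)
      × ((h : ℕ) → 1 ≤ h → (ψ : Sentence σ) → BSNF ψ → EquivDeg≤ d (φ h) ψ →
          2 ^ ((d ∸ 1) ^ (2 ^ h)) < size ψ)))
theorem14 d 3≤d = σ₀ , (λ h → φ (d + h)) , (106 + d * 61 + 61 , size-linear d) , lower-bound
  where
  lower-bound : ∀ h → 1 ≤ h → (ψ : Sentence σ₀) → BSNF ψ → EquivDeg≤ d (φ (d + h)) ψ →
    2 ^ ((d ∸ 1) ^ (2 ^ h)) < size ψ
  -- If |ψ| were small, ψ would have fewer variables than there are labellings;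
  -- transferring 𝔄 ⊨ φ to ψ, then to 𝔅 c₀, and back to φ contradicts 𝔅 c₀ ⊭ φ.
  lower-bound h _ ψ (n , r , θ , θ-local , refl) φ⇔ψ = ≰⇒> λ small →
    let few = <-≤-trans (exs-all-size n θ) (≤-trans small (^-monoʳ-≤ 2 (many-nodes d h)))
        (c₀ , 𝔅⊨ψ) = duplicate n r θ θ-local few (Equivalence.to (φ⇔ψ _ 𝔄 (A.degree≤ d EA 3≤d)) 𝔄⊨φ)
    in 𝔅⊭φ c₀ (Equivalence.from (φ⇔ψ _ (𝔅 c₀) (B.degree≤ c₀ d EB 3≤d)) 𝔅⊨ψ)
    where open Duplication (d + h)
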